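{- Let $V$ be a finite set, and let $\mathcal{B}=\{B_1,\ldots,B_b\}$ and $\mathcal{R}=\{R_1,\ldots,R_r\}$ be families of subsets of $V$ such that: (i) for every $i \in [b]$, $B_i \setminus \bigcup_{i' \ne i} B_{i'} \ne \emptyset$, and for every $j \in [r]$, $R_j \setminus \bigcup_{j' \ne j} R_{j'} \ne \emptyset$; (ii) $|B_i \cap R_j| = 1$ for all $i \in [b]$ and $j \in [r]$. Then $|V| \ge b + r - 1$.
   Context: $[n]$ denotes $\{1,\ldots,n\}$. -}

module Defs where

open import Data.Nat using (ℕ)
open import Data.Fin using (Fin)
open import Data.Fin.Subset using (Subset; _∈_; _∉_; _∩_; ∣_∣)
open import Data.Product using (∃-syntax; _×_)
open import Relation.Binary.PropositionalEquality using (_≡_; _≢_)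

Family : ℕ → ℕ → Set
Family n m = Fin m → Subset n

HasPrivateElements : ∀ {n m} → Family n m → Set
HasPrivateElements {n} {m} F =
  (i : Fin m) → ∃[ v ] (v ∈ F i × ((i' : Fin m) → i' ≢ i → v ∉ F i'))

CrossIntersectOne : ∀ {n b r} → Family n b → Family n r → Set
CrossIntersectOne {n} {b} {r} B R = (i : Fin b) (j : Fin r) → ∣ B i ∩ R j ∣ ≡ 1

-- Work in the GF(2)-vector space Bool^V, pairing vectors by u · v = Σ u x v x.  Pick private
-- elements p i ∈ B i and q j ∈ R j.  The b unit vectors e (p i) together with the r - 1 vectors
-- R j + R 0 (j ≠ 0) are linearly independent: since |B i ∩ R j| = 1 we get R j · B i = 1, so
-- (R j + R 0) · B i = 0 while e (p i′) · B i = [i = i′]; pairing a vanishing combination with B i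
-- kills the coefficients of the e (p i), and evaluating the rest at q j kills the others.
-- Gaussian elimination shows that GF(2)^V contains at most |V| independent vectors.

module Submission where

open import Algebra.Bundles using (CommutativeRing)
open import Data.Bool using (Bool; true; false; not; _∧_; _xor_)
open import Data.Bool.Properties
  using ( xor-∧-commutativeRing; ∧-assoc; ∧-comm; ∧-zeroʳ; ∧-identityʳ; ∧-distribˡ-xor
        ; ∧-distribʳ-xor; xor-assoc; xor-comm; xor-same; xor-identityʳ; ¬-not)
  renaming (_≟_ to _≟ᵇ_)
open import Data.Empty using (⊥-elim)
open import Data.Fin using (Fin; zero; suc; punchIn; _↑ˡ_; _↑ʳ_; splitAt)
open import Data.Fin.Properties using (punchInᵢ≢i; join-splitAt; any?; suc-injective)
open import Data.Fin.Subset using (Subset; _∈_; _∉_; _∩_; ∣_∣; ⁅_⁆)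
open import Data.Fin.Subset.Properties using (x∈⁅x⁆; x≢y⇒x∉⁅y⁆)
open import Data.Nat using (ℕ; zero; suc; _+_; _∸_; _≤_; z≤n; s≤s)
open import Data.Nat.Properties using (≤-trans; m∸n≤m; m≤n⇒m≤1+n; +-identityʳ; +-suc)
open import Data.Product using (_,_; proj₁; proj₂)
open import Data.Sum using (inj₁; inj₂)
open import Data.Vec using ([]; _∷_; lookup)
open import Data.Vec.Functional using (Vector; tail; insertAt; removeAt; _++_)
open import Data.Vec.Functional.Properties
  using (insertAt-lookup; insertAt-punchIn; lookup-++ˡ; lookup-++ʳ)
open import Data.Vec.Properties using ([]=⇒lookup; lookup⇒[]=; lookup-zipWith)
open import Function using (_∘_)
open import Relation.Binary.PropositionalEquality
  using (_≡_; _≢_; refl; sym; trans; cong; cong₂; subst; module ≡-Reasoning)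
open import Relation.Nullary using (yes; no; contradiction)

open import Defs

open CommutativeRing xor-∧-commutativeRing using (semiring)
open import Algebra.Properties.Semiring.Sum semiring
open ≡-Reasoning

∑-zero : ∀ {k} (f : Vector Bool k) → (∀ j → f j ≡ false) → ∑[ j < k ] f j ≡ false
∑-zero {k} f f≡false = trans (sum-cong-≗ f≡false) (sum-replicate-zero k)

∑-single : ∀ {k} (i : Fin k) (f : Vector Bool k) →
           (∀ j → j ≢ i → f j ≡ false) → ∑[ j < k ] f j ≡ f i
∑-single {suc k} i f others = begin
  sum f                       ≡⟨ sum-remove {i = i} f ⟩
  f i xor sum (removeAt f i)  ≡⟨ cong (f i xor_) (∑-zero _ λ j → others _ (punchInᵢ≢i i j)) ⟩
  f i xor false               ≡⟨ xor-identityʳ (f i) ⟩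
  f i                         ∎

∑-splitAt : ∀ {a b} (f : Vector Bool (a + b)) →
            ∑[ k < a + b ] f k ≡ ∑[ i < a ] f (i ↑ˡ b) xor ∑[ j < b ] f (a ↑ʳ j)
∑-splitAt {zero}  f = refl
∑-splitAt {suc a} f =
  trans (cong (f zero xor_) (∑-splitAt {a} (f ∘ suc))) (sym (xor-assoc (f zero) _ _))

splitAt-elim : ∀ {a b} (P : Fin (a + b) → Set) →
               (∀ i → P (i ↑ˡ b)) → (∀ j → P (a ↑ʳ j)) → ∀ k → P k
splitAt-elim {a} {b} P left right k with splitAt a k | join-splitAt a b k
... | inj₁ i | refl = left i
... | inj₂ j | refl = right j

isOdd : ℕ → Bool
isOdd zero    = false
isOdd (suc k) = not (isOdd k)

∑-lookup≡isOdd∣∣ : ∀ {n} (p : Subset n) → ∑[ x < n ] lookup p x ≡ isOdd ∣ p ∣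
∑-lookup≡isOdd∣∣ []          = refl
∑-lookup≡isOdd∣∣ (true ∷ p)  = cong not (∑-lookup≡isOdd∣∣ p)
∑-lookup≡isOdd∣∣ (false ∷ p) = ∑-lookup≡isOdd∣∣ p

∉⇒lookup≡false : ∀ {n} {x : Fin n} {p : Subset n} → x ∉ p → lookup p x ≡ false
∉⇒lookup≡false {x = x} {p} x∉p with lookup p x in eq
... | true  = ⊥-elim (x∉p (lookup⇒[]= x p eq))
... | false = refl

infix 7 _·_

_·_ : ∀ {m} → Vector Bool m → Vector Bool m → Bool
_·_ {m} u v = ∑[ x < m ] (u x ∧ v x)

·-comm : ∀ {m} (u v : Vector Bool m) → u · v ≡ v · u
·-comm u v = sum-cong-≗ λ x → ∧-comm (u x) (v x)

·-zeroˡ : ∀ {m} (u v : Vector Bool m) → (∀ x → u x ≡ false) → u · v ≡ false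
·-zeroˡ u v u≡false = ∑-zero _ λ x → cong (_∧ v x) (u≡false x)

·-distribʳ-xor : ∀ {m} (u u′ v : Vector Bool m) →
                 (λ x → u x xor u′ x) · v ≡ u · v xor u′ · v
·-distribʳ-xor u u′ v =
  trans (sum-cong-≗ λ x → ∧-distribʳ-xor (v x) (u x) (u′ x))
        (∑-distrib-+ (λ x → u x ∧ v x) (λ x → u′ x ∧ v x))

⁅⁆-· : ∀ {m} (y : Fin m) (v : Vector Bool m) → lookup ⁅ y ⁆ · v ≡ v y
⁅⁆-· y v = begin
  lookup ⁅ y ⁆ · v      ≡⟨ ∑-single y _ (λ x x≢y → cong (_∧ v x) (∉⇒lookup≡false (x≢y⇒x∉⁅y⁆ x≢y))) ⟩
  lookup ⁅ y ⁆ y ∧ v y  ≡⟨ cong (_∧ v y) ([]=⇒lookup (x∈⁅x⁆ y)) ⟩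
  v y                   ∎

·-⁅⁆ : ∀ {m} (v : Vector Bool m) (y : Fin m) → v · lookup ⁅ y ⁆ ≡ v y
·-⁅⁆ v y = trans (·-comm v (lookup ⁅ y ⁆)) (⁅⁆-· y v)

lookup-·≡isOdd∣∩∣ : ∀ {m} (p q : Subset m) → lookup p · lookup q ≡ isOdd ∣ p ∩ q ∣
lookup-·≡isOdd∣∩∣ p q =
  trans (sum-cong-≗ λ x → sym (lookup-zipWith _∧_ x p q)) (∑-lookup≡isOdd∣∣ (p ∩ q))

combination : ∀ {k m} → Vector Bool k → (Fin k → Vector Bool m) → Vector Bool m
combination {k} c w x = ∑[ j < k ] (c j ∧ w j x)

LinearlyIndependent : ∀ {k m} → (Fin k → Vector Bool m) → Set
LinearlyIndependent w = ∀ c → (∀ x → combination c w x ≡ false) → ∀ j → c j ≡ false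

combination-insertAt : ∀ {k m} (c : Vector Bool k) (w : Fin (suc k) → Vector Bool m) j₀ t x →
                       combination (insertAt c j₀ t) w x ≡ t ∧ w j₀ x xor combination c (removeAt w j₀) x
combination-insertAt c w j₀ t x = begin
  combination c′ w x
    ≡⟨ sum-remove {i = j₀} (λ j → c′ j ∧ w j x) ⟩
  c′ j₀ ∧ w j₀ x xor combination (removeAt c′ j₀) (removeAt w j₀) x
    ≡⟨ cong₂ _xor_ (cong (_∧ w j₀ x) (insertAt-lookup c j₀ t))
                   (sum-cong-≗ λ j → cong (_∧ w (punchIn j₀ j) x) (insertAt-punchIn c j₀ t j)) ⟩
  t ∧ w j₀ x xor combination c (removeAt w j₀) x ∎
  where c′ = insertAt c j₀ t

tail-independent : ∀ {k m} (w : Fin k → Vector Bool (suc m)) → (∀ j → w j zero ≡ false) →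
                   LinearlyIndependent w → LinearlyIndependent (tail ∘ w)
tail-independent w w₀≡0 w-indep c comb≡0 = w-indep c λ
  { zero    → ∑-zero _ λ j → trans (cong (c j ∧_) (w₀≡0 j)) (∧-zeroʳ (c j))
  ; (suc x) → comb≡0 x }

-- Gaussian elimination with pivot row j₀ on the first coordinate: every other row w j becomes
-- w j + (w j 0) w j₀, whose first coordinate vanishes and is dropped.
eliminate : ∀ {k m} → (Fin (suc k) → Vector Bool (suc m)) → Fin (suc k) → Fin k → Vector Bool m
eliminate w j₀ j x = w (punchIn j₀ j) (suc x) xor w (punchIn j₀ j) zero ∧ w j₀ (suc x)

eliminate-independent : ∀ {k m} (w : Fin (suc k) → Vector Bool (suc m)) j₀ → w j₀ zero ≡ true →
                        LinearlyIndependent w → LinearlyIndependent (eliminate w j₀)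
eliminate-independent {k} {m} w j₀ pivot w-indep c comb≡0 j = begin
  c j                             ≡⟨ insertAt-punchIn c j₀ t j ⟨
  insertAt c j₀ t (punchIn j₀ j)  ≡⟨ w-indep (insertAt c j₀ t) lifted (punchIn j₀ j) ⟩
  false                           ∎
  where
  row : Fin k → Vector Bool (suc m)
  row = removeAt w j₀
  -- The pivot coefficient t cancels the first coordinate of the lifted combination.
  t : Bool
  t = combination c row zero

  lifted : ∀ y → combination (insertAt c j₀ t) w y ≡ false
  lifted zero = begin
    combination (insertAt c j₀ t) w zero  ≡⟨ combination-insertAt c w j₀ t zero ⟩
    t ∧ w j₀ zero xor t                   ≡⟨ cong (λ z → t ∧ z xor t) pivot ⟩
    t ∧ true xor t                        ≡⟨ cong (_xor t) (∧-identityʳ t) ⟩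
    t xor t                               ≡⟨ xor-same t ⟩
    false                                 ∎
  lifted (suc x) = begin
    combination (insertAt c j₀ t) w (suc x)
      ≡⟨ combination-insertAt c w j₀ t (suc x) ⟩
    t ∧ a xor combination c row (suc x)
      ≡⟨ cong (_xor combination c row (suc x)) (*-distribʳ-sum a λ j → c j ∧ row j zero) ⟩
    ∑[ j < k ] ((c j ∧ row j zero) ∧ a) xor ∑[ j < k ] (c j ∧ row j (suc x))
      ≡⟨ ∑-distrib-+ (λ j → (c j ∧ row j zero) ∧ a) (λ j → c j ∧ row j (suc x)) ⟨
    ∑[ j < k ] ((c j ∧ row j zero) ∧ a xor c j ∧ row j (suc x))
      ≡⟨ sum-cong-≗ (λ j → factor (c j) (row j zero) (row j (suc x))) ⟩
    combination c (eliminate w j₀) x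
      ≡⟨ comb≡0 x ⟩
    false ∎
    where
    a : Bool
    a = w j₀ (suc x)
    factor : ∀ γ z s → (γ ∧ z) ∧ a xor γ ∧ s ≡ γ ∧ (s xor z ∧ a)
    factor γ z s = begin
      (γ ∧ z) ∧ a xor γ ∧ s  ≡⟨ cong (_xor γ ∧ s) (∧-assoc γ z a) ⟩
      γ ∧ (z ∧ a) xor γ ∧ s  ≡⟨ ∧-distribˡ-xor γ (z ∧ a) s ⟨
      γ ∧ (z ∧ a xor s)      ≡⟨ cong (γ ∧_) (xor-comm (z ∧ a) s) ⟩
      γ ∧ (s xor z ∧ a)      ∎

independent⇒≤ : ∀ {k m} (w : Fin k → Vector Bool m) → LinearlyIndependent w → k ≤ m
independent⇒≤ {zero}          w w-indep = z≤n
independent⇒≤ {suc k} {zero}  w w-indep = contradiction (w-indep (λ _ → true) (λ ()) zero) λ ()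
independent⇒≤ {suc k} {suc m} w w-indep with any? (λ j → w j zero ≟ᵇ true)
... | yes (j₀ , pivot) =
  s≤s (independent⇒≤ (eliminate w j₀) (eliminate-independent w j₀ pivot w-indep))
... | no no-pivot      =
  m≤n⇒m≤1+n (independent⇒≤ (tail ∘ w)
    (tail-independent w (λ j → ¬-not (no-pivot ∘ (j ,_))) w-indep))

combination-zero : ∀ {k m} (c : Vector Bool k) (w : Fin k → Vector Bool m) →
                   (∀ j → c j ≡ false) → ∀ x → combination c w x ≡ false
combination-zero c w c≡false x = ∑-zero _ λ j → cong (_∧ w j x) (c≡false j)

combination-· : ∀ {k m} (c : Vector Bool k) (w : Fin k → Vector Bool m) (v : Vector Bool m) →
                combination c w · v ≡ ∑[ j < k ] (c j ∧ w j · v)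
combination-· {k} {m} c w v = begin
  ∑[ x < m ] (∑[ j < k ] (c j ∧ w j x) ∧ v x)
    ≡⟨ sum-cong-≗ (λ x → *-distribʳ-sum (v x) λ j → c j ∧ w j x) ⟩
  ∑[ x < m ] ∑[ j < k ] ((c j ∧ w j x) ∧ v x)
    ≡⟨ ∑-comm (λ x j → (c j ∧ w j x) ∧ v x) ⟩
  ∑[ j < k ] ∑[ x < m ] ((c j ∧ w j x) ∧ v x)
    ≡⟨ sum-cong-≗ (λ j → sum-cong-≗ λ x → ∧-assoc (c j) (w j x) (v x)) ⟩
  ∑[ j < k ] ∑[ x < m ] (c j ∧ (w j x ∧ v x))
    ≡⟨ sum-cong-≗ (λ j → *-distribˡ-sum (c j) λ x → w j x ∧ v x) ⟨
  ∑[ j < k ] (c j ∧ w j · v) ∎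

combination-·-dual : ∀ {k m} (w f : Fin k → Vector Bool m) →
                     (∀ j → w j · f j ≡ true) → (∀ i j → i ≢ j → w i · f j ≡ false) →
                     ∀ c j → combination c w · f j ≡ c j
combination-·-dual {k} w f diag off c j = begin
  combination c w · f j         ≡⟨ combination-· c w (f j) ⟩
  ∑[ i < k ] (c i ∧ w i · f j)  ≡⟨ ∑-single j _ (λ i i≢j → trans (cong (c i ∧_) (off i j i≢j)) (∧-zeroʳ _)) ⟩
  c j ∧ w j · f j               ≡⟨ cong (c j ∧_) (diag j) ⟩
  c j ∧ true                    ≡⟨ ∧-identityʳ (c j) ⟩
  c j                           ∎

biorthogonal⇒independent : ∀ {k m} (w f : Fin k → Vector Bool m) →
                           (∀ j → w j · f j ≡ true) → (∀ i j → i ≢ j → w i · f j ≡ false) →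
                           LinearlyIndependent w
biorthogonal⇒independent w f diag off c comb≡0 j =
  trans (sym (combination-·-dual w f diag off c j)) (·-zeroˡ _ (f j) comb≡0)

combination-++ : ∀ {a b m} (c : Vector Bool (a + b)) (u : Fin a → Vector Bool m)
                 (v : Fin b → Vector Bool m) x →
                 combination c (u ++ v) x ≡
                 combination (c ∘ (_↑ˡ b)) u x xor combination (c ∘ (a ↑ʳ_)) v x
combination-++ {a} {b} c u v x = trans (∑-splitAt {a} (λ k → c k ∧ (u ++ v) k x)) (cong₂ _xor_
  (sum-cong-≗ λ i → cong (λ y → c (i ↑ˡ b) ∧ y x) (lookup-++ˡ u v i))
  (sum-cong-≗ λ j → cong (λ y → c (a ↑ʳ j) ∧ y x) (lookup-++ʳ u v j)))

-- Against f the pairing matrix of u ++ v is block triangular with identity top-left block.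
++-independent : ∀ {a b m} (u f : Fin a → Vector Bool m) (v : Fin b → Vector Bool m) →
                 (∀ i → u i · f i ≡ true) → (∀ i i′ → i ≢ i′ → u i · f i′ ≡ false) →
                 (∀ j i → v j · f i ≡ false) → LinearlyIndependent v →
                 LinearlyIndependent (u ++ v)
++-independent {a} {b} {m} u f v diag off v⊥f v-indep c comb≡0 =
  splitAt-elim (λ k → c k ≡ false) cᵤ≡0 cᵥ≡0
  where
  cᵤ : Vector Bool a
  cᵤ i = c (i ↑ˡ b)
  cᵥ : Vector Bool b
  cᵥ j = c (a ↑ʳ j)
  U V : Vector Bool m
  U = combination cᵤ u
  V = combination cᵥ v
  U+V≡0 : ∀ x → U x xor V x ≡ false
  U+V≡0 x = trans (sym (combination-++ c u v x)) (comb≡0 x)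
  cᵤ≡0 : ∀ i → cᵤ i ≡ false
  cᵤ≡0 i = begin
    cᵤ i                         ≡⟨ combination-·-dual u f diag off cᵤ i ⟨
    U · f i                      ≡⟨ xor-identityʳ _ ⟨
    U · f i xor false            ≡⟨ cong (U · f i xor_) V·f≡0 ⟨
    U · f i xor V · f i          ≡⟨ ·-distribʳ-xor U V (f i) ⟨
    (λ x → U x xor V x) · f i    ≡⟨ ·-zeroˡ _ (f i) U+V≡0 ⟩
    false                        ∎
    where
    V·f≡0 : V · f i ≡ false
    V·f≡0 = trans (combination-· cᵥ v (f i))
                  (∑-zero _ λ j → trans (cong (cᵥ j ∧_) (v⊥f j i)) (∧-zeroʳ (cᵥ j)))
  cᵥ≡0 : ∀ j → cᵥ j ≡ false
  cᵥ≡0 = v-indep cᵥ λ x →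
    trans (cong (_xor V x) (sym (combination-zero cᵤ u cᵤ≡0 x))) (U+V≡0 x)

privatePoint : ∀ {n m} {F : Family n m} → HasPrivateElements F → Fin m → Fin n
privatePoint priv i = proj₁ (priv i)

privatePoint-∈ : ∀ {n m} {F : Family n m} (priv : HasPrivateElements F) i →
                 lookup (F i) (privatePoint priv i) ≡ true
privatePoint-∈ priv i = []=⇒lookup (proj₁ (proj₂ (priv i)))

privatePoint-∉ : ∀ {n m} {F : Family n m} (priv : HasPrivateElements F) i i′ → i′ ≢ i →
                 lookup (F i′) (privatePoint priv i) ≡ false
privatePoint-∉ priv i i′ i′≢i = ∉⇒lookup≡false (proj₂ (proj₂ (priv i)) i′ i′≢i)

privateUnitVector : ∀ {n m} {F : Family n m} → HasPrivateElements F → Fin m → Vector Bool n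
privateUnitVector priv i = lookup ⁅ privatePoint priv i ⁆

privateUnitVector-·-diag : ∀ {n m} {F : Family n m} (priv : HasPrivateElements F) i →
                       privateUnitVector priv i · lookup (F i) ≡ true
privateUnitVector-·-diag {F = F} priv i =
  trans (⁅⁆-· (privatePoint priv i) (lookup (F i))) (privatePoint-∈ priv i)

privateUnitVector-·-off : ∀ {n m} {F : Family n m} (priv : HasPrivateElements F) i i′ → i ≢ i′ →
                      privateUnitVector priv i · lookup (F i′) ≡ false
privateUnitVector-·-off {F = F} priv i i′ i≢i′ =
  trans (⁅⁆-· (privatePoint priv i) (lookup (F i′))) (privatePoint-∉ priv i i′ (i≢i′ ∘ sym))

privateUnitVectors-independent : ∀ {n m} (F : Family n m) (priv : HasPrivateElements F) →
                            LinearlyIndependent (privateUnitVector priv)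
privateUnitVectors-independent F priv =
  biorthogonal⇒independent (privateUnitVector priv) (lookup ∘ F)
    (privateUnitVector-·-diag priv) (privateUnitVector-·-off priv)

differences : ∀ {n r} → Family n (suc r) → Fin r → Vector Bool n
differences R j x = lookup (R (suc j)) x xor lookup (R zero) x

differences-independent : ∀ {n r} (R : Family n (suc r)) (priv : HasPrivateElements R) →
                          LinearlyIndependent (differences R)
differences-independent R priv =
  biorthogonal⇒independent (differences R) (privateUnitVector priv ∘ suc) diag off
  where
  diag : ∀ j → differences R j · privateUnitVector priv (suc j) ≡ true
  diag j = trans (·-⁅⁆ (differences R j) _)
    (cong₂ _xor_ (privatePoint-∈ priv (suc j)) (privatePoint-∉ priv (suc j) zero λ ()))
  off : ∀ i j → i ≢ j → differences R i · privateUnitVector priv (suc j) ≡ false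
  off i j i≢j = trans (·-⁅⁆ (differences R i) _)
    (cong₂ _xor_ (privatePoint-∉ priv (suc j) (suc i) (i≢j ∘ suc-injective))
                 (privatePoint-∉ priv (suc j) zero λ ()))

cross-· : ∀ {n b r} (B : Family n b) (R : Family n r) → CrossIntersectOne B R →
          ∀ i j → lookup (R j) · lookup (B i) ≡ true
cross-· B R cross i j = begin
  lookup (R j) · lookup (B i)  ≡⟨ ·-comm (lookup (R j)) (lookup (B i)) ⟩
  lookup (B i) · lookup (R j)  ≡⟨ lookup-·≡isOdd∣∩∣ (B i) (R j) ⟩
  isOdd ∣ B i ∩ R j ∣          ≡⟨ cong isOdd (cross i j) ⟩
  true                         ∎

differences-·-cross : ∀ {n b r} (B : Family n b) (R : Family n (suc r)) → CrossIntersectOne B R →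
                      ∀ j i → differences R j · lookup (B i) ≡ false
differences-·-cross B R cross j i = begin
  differences R j · lookup (B i)
    ≡⟨ ·-distribʳ-xor (lookup (R (suc j))) (lookup (R zero)) (lookup (B i)) ⟩
  lookup (R (suc j)) · lookup (B i) xor lookup (R zero) · lookup (B i)
    ≡⟨ cong₂ _xor_ (cross-· B R cross i (suc j)) (cross-· B R cross i zero) ⟩
  true xor true
    ≡⟨⟩
  false ∎

proposition2 : (n b r : ℕ) (B : Family n b) (R : Family n r) →
    HasPrivateElements B → HasPrivateElements R →
    CrossIntersectOne B R →
    b + r ∸ 1 ≤ n
proposition2 n b zero B _ privB _ _ =
  ≤-trans (m∸n≤m (b + 0) 1)
    (subst (_≤ n) (sym (+-identityʳ b))
      (independent⇒≤ (privateUnitVector privB) (privateUnitVectors-independent B privB)))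
proposition2 n b (suc r) B R privB privR cross =
  subst (λ k → k ∸ 1 ≤ n) (sym (+-suc b r))
    (independent⇒≤ (privateUnitVector privB ++ differences R)
      (++-independent (privateUnitVector privB) (lookup ∘ B) (differences R)
        (privateUnitVector-·-diag privB) (privateUnitVector-·-off privB)
        (differences-·-cross B R cross) (differences-independent R privR)))
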